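{- If $T$ is a tree and $S_1,S_2$ are labelings of $T$ such that $(T,S_1)\in\mathscr{T}$ and $(T,S_2)\in\mathscr{T}$, then $S_1=S_2$.
   Context: A labeling of a tree $T$ is a function $S:V(T)\to\{A,B,C\}$ (the label is called the status). A labeled $K_{1,2}$ is a path on 3 vertices with leaves of status $A$ and center of status $B$. $\mathscr{T}$ is the family of labeled trees $(T,S)$ obtainable from a sequence $(T_1,S_1),\dots,(T_j,S_j)$, $j\ge1$, where $(T_1,S_1)$ is a labeled $K_{1,2}$, $(T,S)=(T_j,S_j)$, and each $(T_{i+1},S_{i+1})$ is obtained from $(T_i,S_i)$ (keeping old statuses) by one of: O1: add a path $x,y,z$ and an edge $ux$, $u\in V(T_i)$ of status $A$ or $C$; statuses $x,z\mapsto A$, $y\mapsto B$. O2: add a star with center $y$ and leaves $x,z,t$ and an edge $ux$, $u$ of status $B$; statuses $x\mapsto C$, $z,t\mapsto A$, $y\mapsto B$. O3: add a path $x,y,z$ and an edge $uy$, $u$ of status $C$; statuses $x,z\mapsto A$, $y\mapsto B$. O4: add a disjoint copy of the labeled tree $R$ (obtained from a labeled $K_{1,2}$ by one application of O2) and an edge $ux$, where $u\in V(T_i)$ has status $A$ or $C$ and $x$ is the unique vertex of status $C$ in $R$. -}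

module Defs where

open import Data.Nat using (ℕ; _≤_; _<_)
open import Data.Fin using (Fin)
open import Data.List using (List; []; _∷_; length)
open import Data.List.Relation.Unary.Unique.Propositional using (Unique)
open import Data.Product using (Σ; _×_; _,_)
open import Data.Sum using (_⊎_; inj₁; inj₂; [_,_])
open import Data.Unit using (⊤)
open import Data.Empty using (⊥)
open import Relation.Binary.PropositionalEquality using (_≡_)
open import Relation.Nullary using (¬_)
open import Function.Bundles using (_⇔_; _⤖_; Bijection)

data Status : Set where
  A B C : Status

data Walk {n : ℕ} (E : Fin n → Fin n → Set) : Fin n → Fin n → Set where
  here : ∀ {u} → Walk E u u
  step : ∀ {u w v} → E u w → Walk E w v → Walk E u v

Chain : {V : Set} → (V → V → Set) → V → List V → Set
Chain E x []       = ⊤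
Chain E x (y ∷ ys) = E x y × Chain E y ys

lastOf : {V : Set} → V → List V → V
lastOf x []       = x
lastOf x (y ∷ ys) = lastOf y ys

IsCycle : {V : Set} → (V → V → Set) → List V → Set
IsCycle E []       = ⊥
IsCycle E (x ∷ xs) =
  (3 ≤ length (x ∷ xs)) × Unique (x ∷ xs) × Chain E x xs × E (lastOf x xs) x

record IsTree {n : ℕ} (E : Fin n → Fin n → Set) : Set where
  field
    nonempty  : 0 < n
    symmetric : ∀ u v → E u v → E v u
    irreflex  : ∀ u → ¬ E u u
    connected : ∀ u v → Walk E u v
    acyclic   : ∀ (vs : List (Fin n)) → ¬ IsCycle E vs

Glue : {V W : Set} → (V → V → Set) → (W → W → Set) → V → W →
       V ⊎ W → V ⊎ W → Set
Glue E F u w (inj₁ a) (inj₁ b) = E a b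
Glue E F u w (inj₂ c) (inj₂ d) = F c d
Glue E F u w (inj₁ a) (inj₂ c) = (a ≡ u) × (c ≡ w)
Glue E F u w (inj₂ c) (inj₁ a) = (a ≡ u) × (c ≡ w)

-- path x , y , z  (vertices p0 , p1 , p2), statuses A , B , A
-- (this is also the labelled K_{1,2})
data P3 : Set where
  p0 p1 p2 : P3

EP3 : P3 → P3 → Set
EP3 p0 p1 = ⊤
EP3 p1 p0 = ⊤
EP3 p1 p2 = ⊤
EP3 p2 p1 = ⊤
EP3 _  _  = ⊥

SP3 : P3 → Status
SP3 p0 = A
SP3 p1 = B
SP3 p2 = A

data St : Set where
  sx sy sz st : St

ESt : St → St → Set
ESt sy sx = ⊤
ESt sx sy = ⊤
ESt sy sz = ⊤
ESt sz sy = ⊤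
ESt sy st = ⊤
ESt st sy = ⊤
ESt _  _  = ⊥

SSt : St → Status
SSt sx = C
SSt sy = B
SSt sz = A
SSt st = A

-- R: the labelled K_{1,2} with one application of O2 (at its center p1,
-- the only vertex of status B). Its unique vertex of status C is inj₂ sx.
RV : Set
RV = P3 ⊎ St

ER : RV → RV → Set
ER = Glue EP3 ESt p1 sx

SR : RV → Status
SR = [ SP3 , SSt ]

-- The family 𝒯, built concretely (new vertices form the right summand)

data Built : (V : Set) → (V → V → Set) → (V → Status) → Set₁ where
  start : Built P3 EP3 SP3
  O1 : ∀ {V E S} → Built V E S → (u : V) → (S u ≡ A ⊎ S u ≡ C) →
       Built (V ⊎ P3) (Glue E EP3 u p0) [ S , SP3 ]
  O2 : ∀ {V E S} → Built V E S → (u : V) → S u ≡ B →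
       Built (V ⊎ St) (Glue E ESt u sx) [ S , SSt ]
  O3 : ∀ {V E S} → Built V E S → (u : V) → S u ≡ C →
       Built (V ⊎ P3) (Glue E EP3 u p1) [ S , SP3 ]
  O4 : ∀ {V E S} → Built V E S → (u : V) → (S u ≡ A ⊎ S u ≡ C) →
       Built (V ⊎ RV) (Glue E ER u (inj₂ sx)) [ S , SR ]

-- (T , S) ∈ 𝒯 : (T , S) is isomorphic (as a labelled graph) to a built one
InFamily : {n : ℕ} → (Fin n → Fin n → Set) → (Fin n → Status) → Set₁
InFamily {n} E S =
  Σ Set λ V → Σ (V → V → Set) λ EV → Σ (V → Status) λ SV →
    Built V EV SV ×
    Σ (V ⤖ Fin n) λ f →
      (∀ a b → EV a b ⇔ E (Bijection.to f a) (Bijection.to f b)) ×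
      (∀ a → S (Bijection.to f a) ≡ SV a)

-- Every labelled tree of the family satisfies three local rules: a vertex of
-- status A has exactly one neighbour of status B, a vertex of status B has two
-- neighbours of status A, and a vertex of status C has two neighbours of
-- status B. These rules hold for the seed and survive each operation, and they
-- are invariant under labelled isomorphism. Two labellings of a tree that both
-- obey the rules cannot differ anywhere: a disagreement at one vertex forces,
-- by the rules, a disagreement one step further along, never going back the way
-- it came. That produces an infinite non-backtracking walk, which a finite tree
-- does not have.
module Submission where

open import Defs
open import Data.Nat using (ℕ; zero; suc; _+_; _∸_; _≤_; _<_; z≤n; s≤s)
open import Data.Nat.Properties
  using (≤-refl; m≤n⇒m<n∨m≡n; m<1+n⇒m≤n; m∸n+n≡m; +-monoˡ-≤; +-monoˡ-<)
open import Data.Fin using (Fin; toℕ)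
open import Data.Fin.Properties using (pigeonhole; toℕ≤pred[n]) renaming (_≟_ to _≟ᶠ_)
open import Data.List using (applyUpTo)
open import Data.List.Relation.Unary.Unique.Propositional.Properties using (applyUpTo⁺₁)
open import Data.Product using (Σ; _×_; _,_; proj₁; proj₂)
open import Data.Sum using (_⊎_; inj₁; inj₂; [_,_]; swap)
open import Data.Sum.Properties using (inj₁-injective; inj₂-injective)
open import Data.Empty using (⊥; ⊥-elim)
open import Data.Unit using (tt)
open import Function using (id; _∘_)
open import Function.Bundles using (_⇔_; _⤖_; Bijection; Equivalence)
open import Function.Definitions using (Injective)
open import Relation.Binary.Definitions using (DecidableEquality)
open import Relation.Binary.PropositionalEquality
  using (_≡_; _≢_; refl; sym; trans; cong; subst; subst₂)
open import Relation.Nullary using (¬_; yes; no; contradiction)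
open import Relation.Nullary.Decidable using (decidable-stable)

_≟ₛ_ : DecidableEquality Status
A ≟ₛ A = yes refl
A ≟ₛ B = no λ ()
A ≟ₛ C = no λ ()
B ≟ₛ A = no λ ()
B ≟ₛ B = yes refl
B ≟ₛ C = no λ ()
C ≟ₛ A = no λ ()
C ≟ₛ B = no λ ()
C ≟ₛ C = yes refl

A-or-C⇒≢B : ∀ {s} → s ≡ A ⊎ s ≡ C → s ≢ B
A-or-C⇒≢B (inj₁ refl) ()
A-or-C⇒≢B (inj₂ refl) ()

module _ {V : Set} (E : V → V → Set) (S : V → Status) where

  Neighbour : Status → V → V → Set
  Neighbour s v w = E v w × S w ≡ s

  UniqueNeighbour : Status → V → Set
  UniqueNeighbour s v = Σ V λ w → Neighbour s v w × (∀ w′ → Neighbour s v w′ → w′ ≡ w)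

  TwoNeighbours : Status → V → Set
  TwoNeighbours s v = Σ V λ w₁ → Σ V λ w₂ → w₁ ≢ w₂ × Neighbour s v w₁ × Neighbour s v w₂

  data Demand : Status → V → Set where
    one-B : ∀ {v} → UniqueNeighbour B v → Demand A v
    two-A : ∀ {v} → TwoNeighbours A v → Demand B v
    two-B : ∀ {v} → TwoNeighbours B v → Demand C v

  AdmissibleAt : V → Set
  AdmissibleAt v = Demand (S v) v

  Admissible : Set
  Admissible = ∀ v → AdmissibleAt v

module _ {V : Set} {E : V → V → Set} {S : V → Status} (admissible : Admissible E S) where

  demand : ∀ {v s} → S v ≡ s → Demand E S s v
  demand refl = admissible _

  B-neighbour-of-A : ∀ {v} → S v ≡ A → UniqueNeighbour E S B v
  B-neighbour-of-A vA with demand vA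
  ... | one-B nb = nb

  A-neighbours-of-B : ∀ {v} → S v ≡ B → TwoNeighbours E S A v
  A-neighbours-of-B vB with demand vB
  ... | two-A nbs = nbs

  B-neighbours-of-C : ∀ {v} → S v ≡ C → TwoNeighbours E S B v
  B-neighbours-of-C vC with demand vC
  ... | two-B nbs = nbs

map-TwoNeighbours : ∀ {V W} {E : V → V → Set} {F : W → W → Set} {S : V → Status} {T : W → Status}
  (f : V → W) → Injective _≡_ _≡_ f → (∀ {x y} → E x y → F (f x) (f y)) → (∀ x → T (f x) ≡ S x) →
  ∀ {s v} → TwoNeighbours E S s v → TwoNeighbours F T s (f v)
map-TwoNeighbours f injective edge status (w₁ , w₂ , w₁≢w₂ , (e₁ , s₁) , (e₂ , s₂)) =
  f w₁ , f w₂ , w₁≢w₂ ∘ injective , (edge e₁ , trans (status w₁) s₁) , (edge e₂ , trans (status w₂) s₂)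

module _ {V W : Set} {E : V → V → Set} {F : W → W → Set} {S : V → Status} {SF : W → Status}
         {u : V} {g : W} where

  private
    inj₁-TwoNeighbours : ∀ {s a} → TwoNeighbours E S s a → TwoNeighbours (Glue E F u g) [ S , SF ] s (inj₁ a)
    inj₁-TwoNeighbours = map-TwoNeighbours {F = Glue E F u g} {T = [ S , SF ]} inj₁ inj₁-injective id (λ _ → refl)

    inj₂-TwoNeighbours : ∀ {s c} → TwoNeighbours F SF s c → TwoNeighbours (Glue E F u g) [ S , SF ] s (inj₂ c)
    inj₂-TwoNeighbours = map-TwoNeighbours {F = Glue E F u g} {T = [ S , SF ]} inj₂ inj₂-injective id (λ _ → refl)

  admissibleAt-glue-inj₁ : (S u ≡ A → SF g ≢ B) →
    ∀ {a} → AdmissibleAt E S a → AdmissibleAt (Glue E F u g) [ S , SF ] (inj₁ a)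
  admissibleAt-glue-inj₁ noNewB {a} = lift refl
    where
    lift : ∀ {s} → S a ≡ s → Demand E S s a → Demand (Glue E F u g) [ S , SF ] s (inj₁ a)
    lift aA (one-B (w , nb , unique)) = one-B (inj₁ w , nb , λ where
      (inj₁ b) nb′                → cong inj₁ (unique b nb′)
      (inj₂ c) ((refl , refl) , gB) → ⊥-elim (noNewB aA gB))
    lift _ (two-A nbs) = two-A (inj₁-TwoNeighbours nbs)
    lift _ (two-B nbs) = two-B (inj₁-TwoNeighbours nbs)

  admissibleAt-glue-inj₂ : (SF g ≡ A → S u ≢ B) →
    ∀ {c} → AdmissibleAt F SF c → AdmissibleAt (Glue E F u g) [ S , SF ] (inj₂ c)
  admissibleAt-glue-inj₂ noNewB {c} = lift refl
    where
    lift : ∀ {s} → SF c ≡ s → Demand F SF s c → Demand (Glue E F u g) [ S , SF ] s (inj₂ c)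
    lift cA (one-B (w , nb , unique)) = one-B (inj₂ w , nb , λ where
      (inj₂ d) nb′                → cong inj₂ (unique d nb′)
      (inj₁ b) ((refl , refl) , uB) → ⊥-elim (noNewB cA uB))
    lift _ (two-A nbs) = two-A (inj₂-TwoNeighbours nbs)
    lift _ (two-B nbs) = two-B (inj₂-TwoNeighbours nbs)

-- The star is not admissible on its own: its C-leaf sx gets its second
-- B-neighbour only through the gluing edge.
admissibleAt-glue-star : ∀ {V} {E : V → V → Set} {S : V → Status} {u} → S u ≡ B →
  ∀ c → AdmissibleAt (Glue E ESt u sx) [ S , SSt ] (inj₂ c)
admissibleAt-glue-star {u = u} uB sx = two-B (inj₁ u , inj₂ sy , (λ ()) , ((refl , refl) , uB) , (tt , refl))
admissibleAt-glue-star uB sy = two-A (inj₂ sz , inj₂ st , (λ ()) , (tt , refl) , (tt , refl))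
admissibleAt-glue-star uB sz = one-B (inj₂ sy , (tt , refl) , λ where
  (inj₂ sy) _ → refl
  (inj₁ _) ((_ , ()) , _)
  (inj₂ sx) (() , _)
  (inj₂ sz) (() , _)
  (inj₂ st) (() , _))
admissibleAt-glue-star uB st = one-B (inj₂ sy , (tt , refl) , λ where
  (inj₂ sy) _ → refl
  (inj₁ _) ((_ , ()) , _)
  (inj₂ sx) (() , _)
  (inj₂ sz) (() , _)
  (inj₂ st) (() , _))

admissible-P3 : Admissible EP3 SP3
admissible-P3 p0 = one-B (p1 , (tt , refl) , λ where
  p1 _ → refl
  p0 (() , _)
  p2 (() , _))
admissible-P3 p1 = two-A (p0 , p2 , (λ ()) , (tt , refl) , (tt , refl))
admissible-P3 p2 = one-B (p1 , (tt , refl) , λ where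
  p1 _ → refl
  p0 (() , _)
  p2 (() , _))

admissible-R : Admissible ER SR
admissible-R (inj₁ a) = admissibleAt-glue-inj₁ (λ ()) (admissible-P3 a)
admissible-R (inj₂ c) = admissibleAt-glue-star refl c

admissible-built : ∀ {V E S} → Built V E S → Admissible E S
admissible-built start = admissible-P3
admissible-built (O1 b _ _)   (inj₁ a) = admissibleAt-glue-inj₁ (λ _ ()) (admissible-built b a)
admissible-built (O1 _ _ uAC) (inj₂ c) = admissibleAt-glue-inj₂ (λ _ → A-or-C⇒≢B uAC) (admissible-P3 c)
admissible-built (O2 b _ _)   (inj₁ a) = admissibleAt-glue-inj₁ (λ _ ()) (admissible-built b a)
admissible-built (O2 _ _ uB)  (inj₂ c) = admissibleAt-glue-star uB c
admissible-built (O3 b _ uC)  (inj₁ a) =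
  admissibleAt-glue-inj₁ (λ uA _ → contradiction (trans (sym uA) uC) λ ()) (admissible-built b a)
admissible-built (O3 _ _ _)   (inj₂ c) = admissibleAt-glue-inj₂ (λ ()) (admissible-P3 c)
admissible-built (O4 b _ _)   (inj₁ a) = admissibleAt-glue-inj₁ (λ _ ()) (admissible-built b a)
admissible-built (O4 _ _ _)   (inj₂ c) = admissibleAt-glue-inj₂ (λ ()) (admissible-R c)

module _ {V W : Set} {EV : V → V → Set} {SV : V → Status} {E : W → W → Set} {S : W → Status}
         (f : V ⤖ W) (edges : ∀ a b → EV a b ⇔ E (Bijection.to f a) (Bijection.to f b))
         (statuses : ∀ a → S (Bijection.to f a) ≡ SV a) where
  open Bijection f using (to; injective; strictlySurjective)

  private
    from : W → V
    from x = proj₁ (strictlySurjective x)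

    to∘from : ∀ x → to (from x) ≡ x
    to∘from x = proj₂ (strictlySurjective x)

    to-edge : ∀ {a b} → EV a b → E (to a) (to b)
    to-edge = Equivalence.to (edges _ _)

    from-edge : ∀ {a x} → E (to a) x → EV a (from x)
    from-edge {a} {x} e = Equivalence.from (edges a (from x)) (subst (E (to a)) (sym (to∘from x)) e)

    from-status : ∀ {x s} → S x ≡ s → SV (from x) ≡ s
    from-status {x} xs = trans (sym (statuses (from x))) (trans (cong S (to∘from x)) xs)

    to-TwoNeighbours : ∀ {s a} → TwoNeighbours EV SV s a → TwoNeighbours E S s (to a)
    to-TwoNeighbours = map-TwoNeighbours {F = E} {T = S} to injective to-edge statuses

  transport-Demand : ∀ {s a} → Demand EV SV s a → Demand E S s (to a)
  transport-Demand (one-B (w , (e , wB) , unique)) =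
    one-B (to w , (to-edge e , trans (statuses w) wB) , λ x (e′ , xB) →
      trans (sym (to∘from x)) (cong to (unique (from x) (from-edge e′ , from-status xB))))
  transport-Demand (two-A nbs) = two-A (to-TwoNeighbours nbs)
  transport-Demand (two-B nbs) = two-B (to-TwoNeighbours nbs)

  admissible-transport : Admissible EV SV → Admissible E S
  admissible-transport admissible x =
    subst₂ (Demand E S) (from-status refl) (to∘from x) (transport-Demand (admissible (from x)))

admissible-family : ∀ {n} {E : Fin n → Fin n → Set} {S} → InFamily E S → Admissible E S
admissible-family (_ , _ , _ , built , f , edges , statuses) =
  admissible-transport f edges statuses (admissible-built built)

chain-applyUpTo : ∀ {V} {E : V → V → Set} (f : ℕ → V) → (∀ t → E (f t) (f (suc t))) →
  ∀ m → Chain E (f 0) (applyUpTo (f ∘ suc) m)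
chain-applyUpTo f adjacent zero    = tt
chain-applyUpTo f adjacent (suc m) = adjacent 0 , chain-applyUpTo (f ∘ suc) (adjacent ∘ suc) m

lastOf-applyUpTo : ∀ {V} (f : ℕ → V) m → lastOf (f 0) (applyUpTo (f ∘ suc) m) ≡ f m
lastOf-applyUpTo f zero    = refl
lastOf-applyUpTo f (suc m) = lastOf-applyUpTo (f ∘ suc) m

module _ {n : ℕ} {E : Fin n → Fin n → Set} (tree : IsTree E) where
  open IsTree tree

  module _ (w : ℕ → Fin n) (adjacent : ∀ k → E (w k) (w (suc k)))
           (nonBacktracking : ∀ k → w (suc (suc k)) ≢ w k) where

    DistinctUpTo : ℕ → Set
    DistinctUpTo k = ∀ {i j} → i < j → j ≤ k → w i ≢ w j

    -- w i , … , w (m + i) , w i would be a closed walk: a loop, a backtrack, or a cycle.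
    no-return : ∀ m i → DistinctUpTo (m + i) → w (suc (m + i)) ≢ w i
    no-return zero          i distinct eq = irreflex (w i) (subst (E (w i)) eq (adjacent i))
    no-return (suc zero)    i distinct eq = nonBacktracking i eq
    no-return m@(suc (suc _)) i distinct eq = acyclic (applyUpTo f (suc m))
      ( s≤s (s≤s (s≤s z≤n))
      , applyUpTo⁺₁ f (suc m) (λ a<b b<1+m → distinct (+-monoˡ-< i a<b) (+-monoˡ-≤ i (m<1+n⇒m≤n b<1+m)))
      , chain-applyUpTo f (λ t → adjacent (t + i)) m
      , subst₂ E (sym (lastOf-applyUpTo f m)) eq (adjacent (m + i)) )
      where
      f : ℕ → Fin n
      f t = w (t + i)

    distinct : ∀ k → DistinctUpTo k
    distinct zero    () z≤n
    distinct (suc k) {i} {j} i<j j≤1+k with m≤n⇒m<n∨m≡n j≤1+k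
    ... | inj₁ j<1+k = distinct k i<j (m<1+n⇒m≤n j<1+k)
    ... | inj₂ refl  = returns ∘ sym
      where
      returns : w (suc k) ≢ w i
      returns = subst (λ l → DistinctUpTo l → w (suc l) ≢ w i) (m∸n+n≡m (m<1+n⇒m≤n i<j))
                  (no-return (k ∸ i) i) (distinct k)

    no-infinite-nonbacktracking-walk : ⊥
    no-infinite-nonbacktracking-walk with pigeonhole (≤-refl {suc n}) (w ∘ toℕ)
    ... | i , j , i<j , eq = distinct n i<j (toℕ≤pred[n] j) eq

  Arc : (Fin n → Fin n → Set) → Set
  Arc P = Σ (Fin n) λ p → Σ (Fin n) λ v → E p v × P p v

  map-Arc : ∀ {P Q : Fin n → Fin n → Set} → (∀ {p v} → P p v → Q p v) → Arc P → Arc Q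
  map-Arc f (p , v , e , q) = p , v , e , f q

  Extendable : (Fin n → Fin n → Set) → Set
  Extendable P = ∀ {p v} → E p v → P p v → Σ (Fin n) λ x → E v x × x ≢ p × P v x

  module _ {P : Fin n → Fin n → Set} (extend : Extendable P) where

    private
      head : Arc P → Fin n
      head (_ , v , _) = v

      next : Arc P → Arc P
      next (p , v , e , q) with extend e q
      ... | x , e′ , _ , q′ = v , x , e′ , q′

      next-adjacent : ∀ a → E (head a) (head (next a))
      next-adjacent (p , v , e , q) with extend e q
      ... | x , e′ , _ , q′ = e′

      next-nonBacktracking : ∀ a → head (next (next a)) ≢ head a
      next-nonBacktracking (p , v , e , q) with extend e q
      ... | x , e′ , _ , q′ = proj₁ (proj₂ (proj₂ (extend e′ q′)))

    extendable⇒no-arc : ¬ Arc P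
    extendable⇒no-arc a =
      no-infinite-nonbacktracking-walk (head ∘ arcs) (next-adjacent ∘ arcs) (next-nonBacktracking ∘ arcs)
      where
      arcs : ℕ → Arc P
      arcs zero    = a
      arcs (suc k) = next (arcs k)

-- A discrepancy on the arc p → v: the labellings differ at v in a way that the
-- local rules force to spread to a neighbour of v other than p.
data Discrepancy {V : Set} (Sa Sb : V → Status) (p v : V) : Set where
  B-only       : Sa v ≢ B → Sb v ≡ B → Discrepancy Sa Sb p v
  anchor-moved : Sa v ≡ A → Sb v ≡ A → Sa p ≢ B → Sb p ≡ B → Discrepancy Sa Sb p v
  A-versus-C   : Sa v ≡ A → Sb v ≡ C → Sa p ≡ B ⊎ Sb p ≢ B → Discrepancy Sa Sb p v

Mismatch : {V : Set} (Sa Sb : V → Status) (p v : V) → Set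
Mismatch Sa Sb p v = Discrepancy Sa Sb p v ⊎ Discrepancy Sb Sa p v

module _ {n : ℕ} {E : Fin n → Fin n → Set} {Sa Sb : Fin n → Status}
         (admissible-a : Admissible E Sa) (admissible-b : Admissible E Sb) where

  B-neighbour-only-in-b : ∀ {v} → Sa v ≡ A → Sb v ≡ C → Σ (Fin n) λ x → Neighbour E Sb B v x × Sa x ≢ B
  B-neighbour-only-in-b vA vC
    with B-neighbours-of-C admissible-b vC | B-neighbour-of-A admissible-a vA
  ... | x₁ , x₂ , x₁≢x₂ , nb₁@(e₁ , _) , nb₂@(e₂ , _) | _ , _ , unique
    with Sa x₁ ≟ₛ B | Sa x₂ ≟ₛ B
  ... | no x₁¬B | _      = x₁ , nb₁ , x₁¬B
  ... | yes _   | no x₂¬B = x₂ , nb₂ , x₂¬B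
  ... | yes x₁B | yes x₂B = ⊥-elim (x₁≢x₂ (trans (unique x₁ (e₁ , x₁B)) (sym (unique x₂ (e₂ , x₂B)))))

  B-only-spreads : ∀ {v w} → Sa v ≢ B → Sb v ≡ B → Sb w ≡ A → Mismatch Sa Sb v w
  B-only-spreads {w = w} v¬B vB wA with Sa w in eq
  ... | A = inj₁ (anchor-moved eq wA v¬B vB)
  ... | B = inj₂ (B-only (λ wB → contradiction (trans (sym wA) wB) λ ()) eq)
  ... | C = inj₂ (A-versus-C wA eq (inj₁ vB))

  discrepancy-spreads : ∀ {p v} → E v p → Discrepancy Sa Sb p v →
    Σ (Fin n) λ x → E v x × x ≢ p × Mismatch Sa Sb v x
  discrepancy-spreads {p} _ (B-only v¬B vB) with A-neighbours-of-B admissible-b vB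
  ... | w₁ , w₂ , w₁≢w₂ , (e₁ , w₁A) , (e₂ , w₂A) with w₁ ≟ᶠ p
  ...   | no w₁≢p  = w₁ , e₁ , w₁≢p , B-only-spreads v¬B vB w₁A
  ...   | yes w₁≡p = w₂ , e₂ , (λ w₂≡p → w₁≢w₂ (trans w₁≡p (sym w₂≡p))) , B-only-spreads v¬B vB w₂A
  discrepancy-spreads {p} vp (anchor-moved vA vA′ p¬B pB) with B-neighbour-of-A admissible-a vA
  ... | x , (e , xB) , _ = x , e , x≢p , inj₂ (B-only x¬B xB)
    where
    x≢p : x ≢ p
    x≢p refl = p¬B xB
    x¬B : Sb x ≢ B
    x¬B x′B with B-neighbour-of-A admissible-b vA′
    ... | _ , _ , unique = x≢p (trans (unique x (e , x′B)) (sym (unique p (vp , pB))))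
  discrepancy-spreads {p} _ (A-versus-C vA vC p-ok) with B-neighbour-only-in-b vA vC
  ... | x , (e , xB) , x¬B = x , e , x≢p p-ok , inj₁ (B-only x¬B xB)
    where
    x≢p : Sa p ≡ B ⊎ Sb p ≢ B → x ≢ p
    x≢p (inj₁ pB) refl = x¬B pB
    x≢p (inj₂ p¬B) refl = p¬B xB

module _ {n : ℕ} {E : Fin n → Fin n → Set} (tree : IsTree E) {S₁ S₂ : Fin n → Status}
         (admissible₁ : Admissible E S₁) (admissible₂ : Admissible E S₂) where
  open IsTree tree using (symmetric)

  mismatch-extendable : Extendable tree (Mismatch S₁ S₂)
  mismatch-extendable pv (inj₁ d) = discrepancy-spreads admissible₁ admissible₂ (symmetric _ _ pv) d
  mismatch-extendable pv (inj₂ d) with discrepancy-spreads admissible₂ admissible₁ (symmetric _ _ pv) d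
  ... | x , e , x≢p , m = x , e , x≢p , swap m

  arc-into-B-only : ∀ {Sa Sb} → Admissible E Sb → ∀ {v s} → Sa v ≡ s → s ≢ B → Sb v ≡ B →
    Arc tree (Discrepancy Sa Sb)
  arc-into-B-only admissible {v} vs s≢B vB with A-neighbours-of-B admissible vB
  ... | w , _ , _ , (e , _) , _ = w , v , symmetric _ _ e , B-only (λ vB′ → s≢B (trans (sym vs) vB′)) vB

  disagreement⇒mismatch : ∀ {v} → S₁ v ≢ S₂ v → Arc tree (Mismatch S₁ S₂)
  disagreement⇒mismatch {v} ne with S₁ v in e₁ | S₂ v in e₂
  ... | A | A = ⊥-elim (ne refl)
  ... | B | B = ⊥-elim (ne refl)
  ... | C | C = ⊥-elim (ne refl)
  ... | A | B = map-Arc tree inj₁ (arc-into-B-only admissible₂ e₁ (λ ()) e₂)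
  ... | C | B = map-Arc tree inj₁ (arc-into-B-only admissible₂ e₁ (λ ()) e₂)
  ... | B | A = map-Arc tree inj₂ (arc-into-B-only admissible₁ e₂ (λ ()) e₁)
  ... | B | C = map-Arc tree inj₂ (arc-into-B-only admissible₁ e₂ (λ ()) e₁)
  ... | A | C with B-neighbour-only-in-b admissible₁ admissible₂ e₁ e₂
  ...   | x , (e , xB) , x¬B = v , x , e , inj₁ (B-only x¬B xB)
  disagreement⇒mismatch {v} ne | C | A with B-neighbour-only-in-b admissible₂ admissible₁ e₂ e₁
  ...   | x , (e , xB) , x¬B = v , x , e , inj₂ (B-only x¬B xB)

  admissible-labellings-agree : ∀ v → S₁ v ≡ S₂ v
  admissible-labellings-agree v = decidable-stable (S₁ v ≟ₛ S₂ v)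
    (extendable⇒no-arc tree mismatch-extendable ∘ disagreement⇒mismatch)

mainTheorem8 : (n : ℕ) (E : Fin n → Fin n → Set) → IsTree E →
    (S₁ S₂ : Fin n → Status) → InFamily E S₁ → InFamily E S₂ →
    ∀ v → S₁ v ≡ S₂ v
mainTheorem8 n E tree S₁ S₂ family₁ family₂ =
  admissible-labellings-agree tree (admissible-family family₁) (admissible-family family₂)
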